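{- Let $n$ be a positive integer. If there exists a Kirkman frame of type $(12;24)^n$, then there exists a Kirkman triple system of order $24n+3$ which contains as a subdesign a Steiner triple system of order $12n+1$.
   Context: An STS$(v)$ is a set of $v$ points with a set of 3-subsets (blocks) such that each pair of distinct points lies in exactly one block; a KTS$(v)$ is an STS$(v)$ whose blocks partition into parallel classes; a subdesign is a subset of points with a subset of blocks forming an STS on that subset. A 3-GDD of type $g^u$ on a point set $V$ is a partition of $V$ into $u$ groups of size $g$ with 3-subset blocks, each meeting every group in at most one point, such that any two points in different groups lie in exactly one block. A Kirkman frame is a 3-GDD whose blocks can be partitioned into partial parallel classes, each a partition of $V\setminus V_i$ for some group $V_i$. A Kirkman frame of type $(g;h)^u$ is a Kirkman frame of type $h^u$ (groups $V_i$, blocks $\mathcal{B}$) together with a 3-GDD of type $g^u$ (groups $W_i$, blocks $\mathcal{A}$) with $W_i\subseteq V_i$ for all $i$ and $\mathcal{A}\subseteq\mathcal{B}$. -}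

module Defs where

open import Data.Nat using (ℕ; _*_; _+_)
open import Data.Fin using (Fin)
open import Data.Product using (Σ; _×_; _,_; ∃)
open import Data.Sum using (_⊎_)
open import Data.Empty using (⊥)
open import Relation.Nullary using (¬_)
open import Relation.Binary.PropositionalEquality using (_≡_)
open import Function.Definitions using (Injective)
open import Function.Bundles using (_⇔_)

-- A 3-subset of X, given by three pairwise distinct elements (order irrelevant:
-- only membership is ever used).
record Triple (X : Set) : Set where
  constructor ⟨_,_,_⟩
  field
    fst snd thd : X

open Triple public

_∈₃_ : {X : Set} → X → Triple X → Set
x ∈₃ t = (x ≡ fst t) ⊎ (x ≡ snd t) ⊎ (x ≡ thd t)

Distinct₃ : {X : Set} → Triple X → Set
Distinct₃ t = ¬ fst t ≡ snd t × ¬ fst t ≡ thd t × ¬ snd t ≡ thd t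

ExactlyOne : {n : ℕ} → (Fin n → Set) → Set
ExactlyOne {n} P = Σ (Fin n) λ i → P i × (∀ j → P j → j ≡ i)

HasSize : {X : Set} → (X → Set) → ℕ → Set
HasSize {X} P k =
  Σ (Fin k → X) λ f → Injective _≡_ _≡_ f × (∀ i → P (f i)) × (∀ x → P x → ∃ λ i → f i ≡ x)

-- Steiner triple systems STS(v) on the point set Fin v.
-- Blocks are indexed by Fin b, so a set of blocks has no repetitions
-- (repetitions would violate "exactly one").

record STS (v : ℕ) : Set where
  field
    b        : ℕ
    blocks   : Fin b → Triple (Fin v)
    distinct : ∀ i → Distinct₃ (blocks i)
    pairs    : ∀ x y → ¬ x ≡ y →
               ExactlyOne (λ i → x ∈₃ blocks i × y ∈₃ blocks i)

record Resolution {v : ℕ} (S : STS v) : Set where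
  open STS S
  field
    r        : ℕ
    cls      : Fin b → Fin r
    parallel : ∀ (c : Fin r) (x : Fin v) →
               ExactlyOne (λ i → cls i ≡ c × x ∈₃ blocks i)

record KTS (v : ℕ) : Set where
  field
    sts        : STS v
    resolution : Resolution sts

record Subdesign {v : ℕ} (S : STS v) (w : ℕ) : Set where
  field
    sub   : STS w
    emb   : Fin w → Fin v
    inj   : Injective _≡_ _≡_ emb
    isBlk : ∀ (j : Fin (STS.b sub)) → Σ (Fin (STS.b S)) λ i →
            ∀ (p : Fin v) → (p ∈₃ STS.blocks S i) ⇔
                            (∃ λ q → emb q ≡ p × q ∈₃ STS.blocks sub j)

record GDD (g u m : ℕ) : Set where
  field
    grp      : Fin m → Fin u
    grpSize  : ∀ (k : Fin u) → HasSize (λ x → grp x ≡ k) g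
    b        : ℕ
    blocks   : Fin b → Triple (Fin m)
    -- each block meets every group in at most one point (hence has 3 distinct points)
    transv   : ∀ i → ¬ grp (fst (blocks i)) ≡ grp (snd (blocks i))
                   × ¬ grp (fst (blocks i)) ≡ grp (thd (blocks i))
                   × ¬ grp (snd (blocks i)) ≡ grp (thd (blocks i))
    pairs    : ∀ x y → ¬ grp x ≡ grp y →
               ExactlyOne (λ i → x ∈₃ blocks i × y ∈₃ blocks i)

record KirkmanFrame (h u m : ℕ) : Set where
  field
    gdd : GDD h u m
  open GDD gdd
  field
    r        : ℕ
    cls      : Fin b → Fin r
    hole     : Fin r → Fin u
    missHole : ∀ (c : Fin r) (x : Fin m) → grp x ≡ hole c →
               ∀ i → cls i ≡ c → ¬ x ∈₃ blocks i
    parallel : ∀ (c : Fin r) (x : Fin m) → ¬ grp x ≡ hole c →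
               ExactlyOne (λ i → cls i ≡ c × x ∈₃ blocks i)

-- Kirkman frame of type (g;h)^u: a Kirkman frame of type h^u (groups V_i,
-- blocks B) with a 3-GDD of type g^u (groups W_i, blocks A) whose point set
-- embeds in that of the frame, with W_i ⊆ V_i and A ⊆ B.
record KirkmanFrame₂ (g h u : ℕ) : Set where
  field
    frame : KirkmanFrame h u (h * u)
    inner : GDD g u (g * u)
    emb   : Fin (g * u) → Fin (h * u)
    inj   : Injective _≡_ _≡_ emb
    sub   : ∀ x → GDD.grp (KirkmanFrame.gdd frame) (emb x) ≡ GDD.grp inner x
    isBlk : ∀ (j : Fin (GDD.b inner)) →
            Σ (Fin (GDD.b (KirkmanFrame.gdd frame))) λ i →
            ∀ (p : Fin (h * u)) →
              (p ∈₃ GDD.blocks (KirkmanFrame.gdd frame) i) ⇔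
              (∃ λ q → emb q ≡ p × q ∈₃ GDD.blocks inner j)

{-# OPTIONS --safe #-}
-- Fill every group V_k of the frame, together with three new points ∞₀ ∞₁ ∞₂, with a copy
-- of an explicit KTS(27) (checked by evaluation) that has {∞₀,∞₁,∞₂} as a block and
-- contains a sub-STS(13) on the twelve points W_k of the inner group plus ∞₀. Counting
-- shows that each hole of a (12;24)^n frame is missed by exactly 12 partial classes;
-- matching these with the 12 classes of the KTS(27) not containing {∞₀,∞₁,∞₂} gives full
-- parallel classes, and the remaining classes of the n copies, with a single copy of
-- {∞₀,∞₁,∞₂}, form one more. The inner GDD together with the n copies of the STS(13) is
-- the required STS(12n+1).

module Submission where

open import Defs
open import Data.Bool using (Bool; true; false; T; _∧_; _∨_; not; if_then_else_)
open import Data.Bool.Properties using (T-∧; T-∨)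
open import Data.Empty using (⊥; ⊥-elim)
open import Data.Fin using (Fin; zero; suc; #_)
open import Data.Fin.Properties using (_≟_; any?; injective⇒≤; suc-injective; +↔⊎; *↔×; 1↔⊤)
open import Data.Nat using (ℕ; zero; suc; _+_; _*_; _≤_)
open import Data.Nat.Properties using (≤-antisym; +-cancelˡ-≡; +-cancelʳ-≡; *-cancelʳ-≡; *-comm)
open import Data.Nat.Tactic.RingSolver using (solve-∀)
open import Data.Product using (Σ; ∃; ∃!; _×_; _,_; proj₁; proj₂; swap)
open import Data.Product.Function.NonDependent.Propositional using (_×-⇔_; _×-↔_)
open import Data.Product.Properties using (,-injective; ,-injectiveˡ)
open import Data.Sum using (_⊎_; inj₁; inj₂; [_,_]; map₁; map₂)
open import Data.Sum.Function.Propositional using (_⊎-↔_)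
open import Data.Sum.Properties using (inj₁-injective; inj₂-injective; ≡-dec)
open import Data.Unit using (⊤; tt)
open import Data.Vec using (Vec; _∷_; []; lookup)
open import Function using (_∘_; id)
open import Function.Bundles using (_⇔_; mk⇔; _↔_; Inverse; Equivalence)
open import Function.Definitions using (Injective)
open import Function.Properties.Equivalence using () renaming (trans to ⇔-trans; sym to ⇔-sym)
open import Function.Properties.Inverse using (↔-refl; ↔-sym; ↔-trans)
open import Relation.Binary.Definitions using (DecidableEquality)
open import Relation.Binary.PropositionalEquality using (_≡_; _≢_; refl; sym; trans; cong; cong₂; subst; module ≡-Reasoning)
open import Relation.Nullary using (¬_; Dec; yes; no)
open import Relation.Nullary.Decidable using (does; toSum; _⊎-dec_; _×-dec_; ¬?; map′)
open import Relation.Unary using (Decidable)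

variable
  A A′ X X′ Y Y′ B B′ C C′ Bs Bs′ : Set

map₃ : (X → Y) → Triple X → Triple Y
map₃ f ⟨ a , b , c ⟩ = ⟨ f a , f b , f c ⟩

∈₃-map⁺ : (f : X → Y) (t : Triple X) {x : X} → x ∈₃ t → f x ∈₃ map₃ f t
∈₃-map⁺ f t (inj₁ refl)        = inj₁ refl
∈₃-map⁺ f t (inj₂ (inj₁ refl)) = inj₂ (inj₁ refl)
∈₃-map⁺ f t (inj₂ (inj₂ refl)) = inj₂ (inj₂ refl)

∈₃-map⁻ : (f : X → Y) (t : Triple X) {y : Y} → y ∈₃ map₃ f t → ∃ λ x → f x ≡ y × x ∈₃ t
∈₃-map⁻ f t (inj₁ refl)        = fst t , refl , inj₁ refl
∈₃-map⁻ f t (inj₂ (inj₁ refl)) = snd t , refl , inj₂ (inj₁ refl)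
∈₃-map⁻ f t (inj₂ (inj₂ refl)) = thd t , refl , inj₂ (inj₂ refl)

∈₃-map-injective : {f : X → Y} → Injective _≡_ _≡_ f → (t : Triple X) {x : X} →
                   f x ∈₃ map₃ f t → x ∈₃ t
∈₃-map-injective f-inj t m with ∈₃-map⁻ _ t m
... | x , fx≡ , x∈t = subst (_∈₃ t) (f-inj fx≡) x∈t

∈₃-map-injective⇔ : {f : X → Y} → Injective _≡_ _≡_ f → (t : Triple X) {x : X} →
                    f x ∈₃ map₃ f t ⇔ x ∈₃ t
∈₃-map-injective⇔ f-inj t = mk⇔ (∈₃-map-injective f-inj t) (∈₃-map⁺ _ t)

∈₃-map⇔ : (f : X → Y) (t : Triple X) {y : Y} → y ∈₃ map₃ f t ⇔ (∃ λ x → f x ≡ y × x ∈₃ t)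
∈₃-map⇔ f t = mk⇔ (∈₃-map⁻ f t) λ { (x , refl , x∈t) → ∈₃-map⁺ f t x∈t }

map₃-cong : {f f′ : X → Y} → (∀ x → f x ≡ f′ x) → (t : Triple X) → map₃ f t ≡ map₃ f′ t
map₃-cong f≗f′ ⟨ a , b , c ⟩ rewrite f≗f′ a | f≗f′ b | f≗f′ c = refl

Distinct₃-map : {f : X → Y} → Injective _≡_ _≡_ f → (t : Triple X) → Distinct₃ t → Distinct₃ (map₃ f t)
Distinct₃-map f-inj t (a≢b , a≢c , b≢c) = a≢b ∘ f-inj , a≢c ∘ f-inj , b≢c ∘ f-inj

_∈₃?_ : ∀ {n} (x : Fin n) (t : Triple (Fin n)) → Dec (x ∈₃ t)
x ∈₃? t = (x ≟ fst t) ⊎-dec (x ≟ snd t) ⊎-dec (x ≟ thd t)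

∃!-unique : {P : X → Set} → ∃! _≡_ P → ∀ {x y} → P x → P y → x ≡ y
∃!-unique (_ , _ , unique) px py = trans (sym (unique px)) (unique py)

∃!-⇔ : {P Q : X → Set} → (∀ x → P x ⇔ Q x) → ∃! _≡_ P → ∃! _≡_ Q
∃!-⇔ P⇔Q (x , px , unique) = x , Equivalence.to (P⇔Q x) px , λ {y} qy → unique (Equivalence.from (P⇔Q y) qy)

∃!-inj₁ : {P : A ⊎ A′ → Set} → ∃! _≡_ (P ∘ inj₁) → (∀ b → ¬ P (inj₂ b)) → ∃! _≡_ P
∃!-inj₁ (a , pa , unique) none = inj₁ a , pa , λ
  { {inj₁ _} pa′ → cong inj₁ (unique pa′)
  ; {inj₂ b} pb  → ⊥-elim (none b pb) }

∃!-inj₂ : {P : A ⊎ A′ → Set} → ∃! _≡_ (P ∘ inj₂) → (∀ a → ¬ P (inj₁ a)) → ∃! _≡_ P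
∃!-inj₂ (b , pb , unique) none = inj₂ b , pb , λ
  { {inj₁ a} pa  → ⊥-elim (none a pa)
  ; {inj₂ _} pb′ → cong inj₂ (unique pb′) }

∃!-inj₁⁻ : {P : A ⊎ A′ → Set} → ∃! _≡_ P → (∀ b → ¬ P (inj₂ b)) → ∃! _≡_ (P ∘ inj₁)
∃!-inj₁⁻ (inj₁ a , pa , unique) none = a , pa , λ pa′ → inj₁-injective (unique pa′)
∃!-inj₁⁻ (inj₂ b , pb , _)      none = ⊥-elim (none b pb)

∃!-at : {P : A × A′ → Set} (a : A) → ∃! _≡_ (λ b → P (a , b)) → (∀ {a′ b} → P (a′ , b) → a′ ≡ a) → ∃! _≡_ P
∃!-at {P = P} a (b , pb , unique) only-a = (a , b) , pb , λ { {a′ , b′} pab′ → at-a (only-a pab′) pab′ }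
  where
  at-a : ∀ {a′ b′} → a′ ≡ a → P (a′ , b′) → (a , b) ≡ (a′ , b′)
  at-a refl pab′ = cong (a ,_) (unique pab′)

module _ (I : X ↔ X′) where
  open Inverse I

  ↔-injective : Injective _≡_ _≡_ to
  ↔-injective {x} {y} tx≡ty = begin
    x              ≡⟨ sym (strictlyInverseʳ x) ⟩
    from (to x)    ≡⟨ cong from tx≡ty ⟩
    from (to y)    ≡⟨ strictlyInverseʳ y ⟩
    y              ∎
    where open ≡-Reasoning

  ∃!-reindex : {P : X → Set} → ∃! _≡_ P → ∃! _≡_ (P ∘ from)
  ∃!-reindex {P} (x , px , unique) =
    to x , subst P (sym (strictlyInverseʳ x)) px ,
    λ {y} py → trans (cong to (unique py)) (strictlyInverseˡ y)

  ∈₃-map-↔ : (t : Triple X) {x′ : X′} → x′ ∈₃ map₃ to t ⇔ from x′ ∈₃ t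
  ∈₃-map-↔ t {x′} = mk⇔
    (λ m → ∈₃-map-injective ↔-injective t (subst (_∈₃ map₃ to t) (sym (strictlyInverseˡ x′)) m))
    (λ m → subst (_∈₃ map₃ to t) (strictlyInverseˡ x′) (∈₃-map⁺ to t m))

-- The designs of Defs over arbitrary point, block and class types, so that these can be built
-- from sums and products; they are transported to Fin at the end.
record STSOn (X B : Set) : Set where
  field
    blocks   : B → Triple X
    distinct : ∀ i → Distinct₃ (blocks i)
    pairs    : ∀ x y → x ≢ y → ∃! _≡_ λ i → x ∈₃ blocks i × y ∈₃ blocks i

record KTSOn (X B C : Set) : Set where
  field
    sts : STSOn X B
  open STSOn sts public
  field
    cls      : B → C
    parallel : ∀ c x → ∃! _≡_ λ i → cls i ≡ c × x ∈₃ blocks i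

record SubdesignOn (S : STSOn X B) (Y Bs : Set) : Set where
  field
    sub   : STSOn Y Bs
    emb   : Y → X
    inj   : Injective _≡_ _≡_ emb
    isBlk : ∀ j → Σ B λ i → ∀ x →
            x ∈₃ STSOn.blocks S i ⇔ (∃ λ y → emb y ≡ x × y ∈₃ STSOn.blocks sub j)

module _ (I : X ↔ X′) (J : B ↔ B′) where
  open Inverse

  STSOn-transport : STSOn X B → STSOn X′ B′
  STSOn-transport S = record
    { blocks   = map₃ (to I) ∘ blocks ∘ from J
    ; distinct = λ i → Distinct₃-map (↔-injective I) _ (distinct (from J i))
    ; pairs    = λ x y x≢y →
        ∃!-⇔ (λ i → ⇔-sym (∈₃-map-↔ I _ ×-⇔ ∈₃-map-↔ I _))
                (∃!-reindex J (pairs (from I x) (from I y) (x≢y ∘ ↔-injective (↔-sym I))))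
    }
    where open STSOn S

  KTSOn-transport : (K : C ↔ C′) → KTSOn X B C → KTSOn X′ B′ C′
  KTSOn-transport K T = record
    { sts      = STSOn-transport (KTSOn.sts T)
    ; cls      = to K ∘ cls ∘ from J
    ; parallel = λ c x →
        ∃!-⇔ (λ i → ⇔-sym (class⇔ ×-⇔ ∈₃-map-↔ I _))
                (∃!-reindex J (parallel (from K c) (from I x)))
    }
    where
    open KTSOn T
    class⇔ : ∀ {a c} → to K a ≡ c ⇔ a ≡ from K c
    class⇔ = mk⇔ (λ e → sym (inverseʳ K (sym e))) (inverseˡ K)

module _ {S : STSOn X B} (I : X ↔ X′) (J : B ↔ B′) (K : Y ↔ Y′) (L : Bs ↔ Bs′) where
  open Inverse

  SubdesignOn-transport : SubdesignOn S Y Bs → SubdesignOn (STSOn-transport I J S) Y′ Bs′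
  SubdesignOn-transport D = record
    { sub   = STSOn-transport K L sub
    ; emb   = to I ∘ emb ∘ from K
    ; inj   = ↔-injective (↔-sym K) ∘ inj ∘ ↔-injective I
    ; isBlk = λ j → let (i , i-image) = isBlk (from L j) in
        to J i , λ x → ⇔-trans (∈₃-map-↔ I _)
          (subst (λ i′ → from I x ∈₃ STSOn.blocks S i′ ⇔ _) (sym (strictlyInverseʳ J i))
            (⇔-trans (i-image (from I x)) image⇔))
    }
    where
    open SubdesignOn D
    image⇔ : ∀ {s : Triple Y} {x} →
             (∃ λ y → emb y ≡ from I x × y ∈₃ s) ⇔ (∃ λ y′ → to I (emb (from K y′)) ≡ x × y′ ∈₃ map₃ (to K) s)
    image⇔ {s} = mk⇔
      (λ (y , e , m) → to K y ,
         trans (cong (to I ∘ emb) (strictlyInverseʳ K y)) (inverseˡ I e) , ∈₃-map⁺ (to K) s m)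
      (λ (y′ , e , m) → from K y′ , sym (inverseʳ I (sym e)) , Equivalence.to (∈₃-map-↔ K s) m)

∃!⇒ExactlyOne : ∀ {n} {P : Fin n → Set} → ∃! _≡_ P → ExactlyOne P
∃!⇒ExactlyOne (i , pi , unique) = i , pi , λ j pj → sym (unique pj)

ExactlyOne⇒∃! : ∀ {n} {P : Fin n → Set} → ExactlyOne P → ∃! _≡_ P
ExactlyOne⇒∃! (i , pi , unique) = i , pi , λ pj → sym (unique _ pj)

ExactlyOne-unique : ∀ {n} {P : Fin n → Set} → ExactlyOne P → ∀ {i j} → P i → P j → i ≡ j
ExactlyOne-unique (_ , _ , unique) pi pj = trans (unique _ pi) (sym (unique _ pj))

toSTS : ∀ {v b} → STSOn (Fin v) (Fin b) → STS v
toSTS {b = b} S = record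
  { b = b ; blocks = blocks ; distinct = distinct
  ; pairs = λ x y x≢y → ∃!⇒ExactlyOne (pairs x y x≢y) }
  where open STSOn S

toKTS : ∀ {v b r} → KTSOn (Fin v) (Fin b) (Fin r) → KTS v
toKTS {r = r} T = record
  { sts        = toSTS (KTSOn.sts T)
  ; resolution = record
    { r = r ; cls = cls ; parallel = λ c x → ∃!⇒ExactlyOne (parallel c x) } }
  where open KTSOn T

toSubdesign : ∀ {v b w bs} {S : STSOn (Fin v) (Fin b)} →
              SubdesignOn S (Fin w) (Fin bs) → Subdesign (toSTS S) w
toSubdesign D = record { sub = toSTS sub ; emb = emb ; inj = inj ; isBlk = isBlk }
  where open SubdesignOn D

⊎↔Fin : ∀ {a b} → A ↔ Fin a → B ↔ Fin b → (A ⊎ B) ↔ Fin (a + b)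
⊎↔Fin {a = a} {b} I J = ↔-trans (I ⊎-↔ J) (↔-sym (+↔⊎ {a} {b}))

×↔Fin : ∀ {a b} → A ↔ Fin a → B ↔ Fin b → (A × B) ↔ Fin (a * b)
×↔Fin {a = a} {b} I J = ↔-trans (I ×-↔ J) (↔-sym (*↔× {a} {b}))

⊤↔Fin1 : ⊤ ↔ Fin 1
⊤↔Fin1 = ↔-sym 1↔⊤

KTSOn-withSubdesign⇒KTS : ∀ {v b r w bs} (K : KTSOn X B C) → SubdesignOn (KTSOn.sts K) Y Bs →
  X ↔ Fin v → B ↔ Fin b → C ↔ Fin r → Y ↔ Fin w → Bs ↔ Fin bs →
  Σ (KTS v) λ K′ → Subdesign (KTS.sts K′) w
KTSOn-withSubdesign⇒KTS K D I J L M N =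
  toKTS (KTSOn-transport I J L K) , toSubdesign (SubdesignOn-transport I J M N D)

-- HasSize P k is, by definition, Enumeration (Fin k) P.
Enumeration : {X : Set} → Set → (X → Set) → Set
Enumeration {X} A P =
  Σ (A → X) λ f → Injective _≡_ _≡_ f × (∀ i → P (f i)) × (∀ x → P x → ∃ λ i → f i ≡ x)

Enumeration-resp : {P Q : X → Set} → (∀ x → P x → Q x) → (∀ x → Q x → P x) →
                   Enumeration A P → Enumeration A Q
Enumeration-resp P⇒Q Q⇒P (f , f-inj , f-mem , f-onto) =
  f , f-inj , (λ i → P⇒Q _ (f-mem i)) , (λ x qx → f-onto x (Q⇒P x qx))

Enumeration-reindex : {P : X → Set} → A′ ↔ A → Enumeration A P → Enumeration A′ P
Enumeration-reindex I (f , f-inj , f-mem , f-onto) =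
  f ∘ to , ↔-injective I ∘ f-inj , f-mem ∘ to ,
  λ x px → let (i , fi≡x) = f-onto x px in from i , trans (cong f (strictlyInverseˡ i)) fi≡x
  where open Inverse I

Enumeration-⊎ : {P Q : X → Set} → Enumeration A P → Enumeration A′ Q →
                (∀ x → P x → Q x → ⊥) → Enumeration (A ⊎ A′) (λ x → P x ⊎ Q x)
Enumeration-⊎ {P = P} {Q = Q} (f , f-inj , f-mem , f-onto) (g , g-inj , g-mem , g-onto) disjoint =
  h , h-inj , h-mem , h-onto
  where
  h = [ f , g ]
  h-inj : Injective _≡_ _≡_ h
  h-inj {inj₁ i} {inj₁ j} e = cong inj₁ (f-inj e)
  h-inj {inj₁ i} {inj₂ j} e = ⊥-elim (disjoint _ (f-mem i) (subst Q (sym e) (g-mem j)))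
  h-inj {inj₂ i} {inj₁ j} e = ⊥-elim (disjoint _ (f-mem j) (subst Q e (g-mem i)))
  h-inj {inj₂ i} {inj₂ j} e = cong inj₂ (g-inj e)
  h-mem : ∀ s → P (h s) ⊎ Q (h s)
  h-mem (inj₁ i) = inj₁ (f-mem i)
  h-mem (inj₂ j) = inj₂ (g-mem j)
  h-onto : ∀ x → P x ⊎ Q x → ∃ λ s → h s ≡ x
  h-onto x (inj₁ px) = let (i , e) = f-onto x px in inj₁ i , e
  h-onto x (inj₂ qx) = let (j , e) = g-onto x qx in inj₂ j , e

Enumeration-Σ : {K : Set} {Q : K → X → Set} → (∀ k → Enumeration A (Q k)) →
                (∀ k k′ x → Q k x → Q k′ x → k ≡ k′) → Enumeration (K × A) (λ x → ∃ λ k → Q k x)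
Enumeration-Σ {Q = Q} enum disjoint = h , h-inj , h-mem , h-onto
  where
  f = λ k → proj₁ (enum k)
  f-inj : ∀ k → Injective _≡_ _≡_ (f k)
  f-inj k = proj₁ (proj₂ (enum k))
  f-mem = λ k → proj₁ (proj₂ (proj₂ (enum k)))
  f-onto = λ k → proj₂ (proj₂ (proj₂ (enum k)))
  h = λ (k , i) → f k i
  h-inj : Injective _≡_ _≡_ h
  h-inj {k , i} {k′ , i′} e with disjoint k k′ _ (f-mem k i) (subst (Q k′) (sym e) (f-mem k′ i′))
  ... | refl = cong (k ,_) (f-inj k e)
  h-mem = λ (k , i) → k , f-mem k i
  h-onto = λ x (k , qx) → let (i , e) = f-onto k x qx in (k , i) , e

HasSize-⊎ : {P Q : X → Set} {a b : ℕ} → HasSize P a → HasSize Q b →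
            (∀ x → P x → Q x → ⊥) → HasSize (λ x → P x ⊎ Q x) (a + b)
HasSize-⊎ p q disjoint = Enumeration-reindex +↔⊎ (Enumeration-⊎ p q disjoint)

HasSize-Σ : ∀ {n a} {Q : Fin n → X → Set} → (∀ k → HasSize (Q k) a) →
            (∀ k k′ x → Q k x → Q k′ x → k ≡ k′) → HasSize (λ x → ∃ λ k → Q k x) (n * a)
HasSize-Σ q disjoint = Enumeration-reindex *↔× (Enumeration-Σ q disjoint)

HasSize-≤ : {P : X → Set} {a b : ℕ} → HasSize P a → HasSize P b → a ≤ b
HasSize-≤ (f , f-inj , f-mem , _) (g , _ , _ , g-onto) = injective⇒≤ index-inj
  where
  index = λ i → proj₁ (g-onto (f i) (f-mem i))
  index-inj : Injective _≡_ _≡_ index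
  index-inj {i} {j} e = f-inj (begin
    f i                ≡⟨ sym (proj₂ (g-onto _ (f-mem i))) ⟩
    g (index i)        ≡⟨ cong g e ⟩
    g (index j)        ≡⟨ proj₂ (g-onto _ (f-mem j)) ⟩
    f j                ∎)
    where open ≡-Reasoning

HasSize-unique : {P : X → Set} {a b : ℕ} → HasSize P a → HasSize P b → a ≡ b
HasSize-unique p q = ≤-antisym (HasSize-≤ p q) (HasSize-≤ q p)

HasSize-universal : ∀ n → HasSize {Fin n} (λ _ → ⊤) n
HasSize-universal n = id , id , (λ _ → tt) , (λ x _ → x , refl)

HasSize-decidable : ∀ {n} {P : Fin n → Set} → Decidable P → ∃ (HasSize P)
HasSize-decidable {zero} P? = 0 , (λ ()) , (λ {}) , (λ ()) , (λ ())
HasSize-decidable {suc n} {P} P? with HasSize-decidable (P? ∘ suc)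
... | m , f , f-inj , f-mem , f-onto with P? zero
...   | no ¬p0 = m , suc ∘ f , f-inj ∘ suc-injective , f-mem , onto
  where
  onto : ∀ x → P x → ∃ λ i → suc (f i) ≡ x
  onto zero    p0 = ⊥-elim (¬p0 p0)
  onto (suc x) px = let (i , e) = f-onto x px in i , cong suc e
...   | yes p0 = suc m , g , g-inj , g-mem , g-onto
  where
  g : Fin (suc m) → Fin (suc n)
  g zero    = zero
  g (suc i) = suc (f i)
  g-inj : Injective _≡_ _≡_ g
  g-inj {zero}  {zero}  _ = refl
  g-inj {suc i} {suc j} e = cong suc (f-inj (suc-injective e))
  g-mem : ∀ i → P (g i)
  g-mem zero    = p0
  g-mem (suc i) = f-mem i
  g-onto : ∀ x → P x → ∃ λ i → g i ≡ x
  g-onto zero    _  = zero , refl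
  g-onto (suc x) px = let (i , e) = f-onto x px in suc i , cong suc e

HasSize-pair : {a b : X} → a ≢ b → HasSize (λ z → z ≡ a ⊎ z ≡ b) 2
HasSize-pair {a = a} {b} a≢b = f , f-inj , f-mem , f-onto
  where
  f : Fin 2 → _
  f zero       = a
  f (suc zero) = b
  f-inj : Injective _≡_ _≡_ f
  f-inj {zero}     {zero}     _ = refl
  f-inj {zero}     {suc zero} e = ⊥-elim (a≢b e)
  f-inj {suc zero} {zero}     e = ⊥-elim (a≢b (sym e))
  f-inj {suc zero} {suc zero} _ = refl
  f-mem : ∀ i → f i ≡ a ⊎ f i ≡ b
  f-mem zero       = inj₁ refl
  f-mem (suc zero) = inj₂ refl
  f-onto : ∀ z → z ≡ a ⊎ z ≡ b → ∃ λ i → f i ≡ z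
  f-onto z (inj₁ refl) = zero , refl
  f-onto z (inj₂ refl) = suc zero , refl

HasSize-others : (t : Triple X) → Distinct₃ t → ∀ {y} → y ∈₃ t → HasSize (λ z → z ∈₃ t × z ≢ y) 2
HasSize-others t (a≢b , a≢c , b≢c) (inj₁ refl) =
  Enumeration-resp (λ _ → [ (λ e → inj₂ (inj₁ e) , λ e′ → a≢b (trans (sym e′) e)) ,
                            (λ e → inj₂ (inj₂ e) , λ e′ → a≢c (trans (sym e′) e)) ])
                   (λ _ → λ { (inj₁ e , z≢a) → ⊥-elim (z≢a e) ; (inj₂ m , _) → m })
                   (HasSize-pair b≢c)
HasSize-others t (a≢b , a≢c , b≢c) (inj₂ (inj₁ refl)) =
  Enumeration-resp (λ _ → [ (λ e → inj₁ e , λ e′ → a≢b (trans (sym e) e′)) ,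
                            (λ e → inj₂ (inj₂ e) , λ e′ → b≢c (trans (sym e′) e)) ])
                   (λ _ → λ { (inj₁ e , _) → inj₁ e ; (inj₂ (inj₁ e) , z≢b) → ⊥-elim (z≢b e)
                            ; (inj₂ (inj₂ e) , _) → inj₂ e })
                   (HasSize-pair a≢c)
HasSize-others t (a≢b , a≢c , b≢c) (inj₂ (inj₂ refl)) =
  Enumeration-resp (λ _ → [ (λ e → inj₁ e , λ e′ → a≢c (trans (sym e) e′)) ,
                            (λ e → inj₂ (inj₁ e) , λ e′ → b≢c (trans (sym e) e′)) ])
                   (λ _ → λ { (inj₁ e , _) → inj₁ e ; (inj₂ (inj₁ e) , _) → inj₂ e
                            ; (inj₂ (inj₂ e) , z≢c) → ⊥-elim (z≢c e) })
                   (HasSize-pair a≢b)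

module _ {h u m : ℕ} (D : GDD h u m) where
  open GDD D

  inBlock-sameGroup⇒≡ : ∀ i {x y} → x ∈₃ blocks i → y ∈₃ blocks i → grp x ≡ grp y → x ≡ y
  inBlock-sameGroup⇒≡ i mx my e with transv i
  inBlock-sameGroup⇒≡ i (inj₁ refl)        (inj₁ refl)        e | _ = refl
  inBlock-sameGroup⇒≡ i (inj₁ refl)        (inj₂ (inj₁ refl)) e | ab , ac , bc = ⊥-elim (ab e)
  inBlock-sameGroup⇒≡ i (inj₁ refl)        (inj₂ (inj₂ refl)) e | ab , ac , bc = ⊥-elim (ac e)
  inBlock-sameGroup⇒≡ i (inj₂ (inj₁ refl)) (inj₁ refl)        e | ab , ac , bc = ⊥-elim (ab (sym e))
  inBlock-sameGroup⇒≡ i (inj₂ (inj₁ refl)) (inj₂ (inj₁ refl)) e | _ = refl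
  inBlock-sameGroup⇒≡ i (inj₂ (inj₁ refl)) (inj₂ (inj₂ refl)) e | ab , ac , bc = ⊥-elim (bc e)
  inBlock-sameGroup⇒≡ i (inj₂ (inj₂ refl)) (inj₁ refl)        e | ab , ac , bc = ⊥-elim (ac (sym e))
  inBlock-sameGroup⇒≡ i (inj₂ (inj₂ refl)) (inj₂ (inj₁ refl)) e | ab , ac , bc = ⊥-elim (bc (sym e))
  inBlock-sameGroup⇒≡ i (inj₂ (inj₂ refl)) (inj₂ (inj₂ refl)) e | _ = refl

  GDD-distinct : ∀ i → Distinct₃ (blocks i)
  GDD-distinct i = let (ab , ac , bc) = transv i in ab ∘ cong grp , ac ∘ cong grp , bc ∘ cong grp

  -- The blocks through y split the points outside its group into pairs.
  GDD-replication : ∀ y {β} → HasSize (λ i → y ∈₃ blocks i) β → h + β * 2 ≡ m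
  GDD-replication y {β} (e , e-inj , e-mem , e-onto) =
    HasSize-unique (Enumeration-resp (λ _ _ → tt) (λ z _ → toSum (grp z ≟ grp y))
                     (HasSize-⊎ (grpSize (grp y)) outside (λ z z∈Gy z∉Gy → z∉Gy z∈Gy)))
                   (HasSize-universal m)
    where
    Partner : Fin β → Fin m → Set
    Partner i z = z ∈₃ blocks (e i) × z ≢ y
    partner-outside : ∀ i z → Partner i z → grp z ≢ grp y
    partner-outside i z (z∈ , z≢y) = z≢y ∘ inBlock-sameGroup⇒≡ (e i) z∈ (e-mem i)
    outside : HasSize (λ z → grp z ≢ grp y) (β * 2)
    outside =
      Enumeration-resp (λ z (i , p) → partner-outside i z p) partnerOf
        (HasSize-Σ (λ i → HasSize-others _ (GDD-distinct (e i)) (e-mem i)) partner-unique)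
      where
      partner-unique : ∀ i i′ z → Partner i z → Partner i′ z → i ≡ i′
      partner-unique i i′ z (z∈ , z≢y) (z∈′ , _) =
        e-inj (ExactlyOne-unique (pairs y z (partner-outside i z (z∈ , z≢y) ∘ sym)) (e-mem i , z∈) (e-mem i′ , z∈′))
      partnerOf : ∀ z → grp z ≢ grp y → ∃ λ i → Partner i z
      partnerOf z ne = let (j , (y∈ , z∈) , _) = pairs y z (ne ∘ sym)
                           (i , ei≡j) = e-onto j y∈
                       in i , subst (λ j → z ∈₃ blocks j) (sym ei≡j) z∈ , λ z≡y → ne (cong grp z≡y)

module _ {h u m : ℕ} (F : KirkmanFrame h u m) where
  open KirkmanFrame F
  open GDD gdd

  classesNotMissing-size : ∀ y {β} → HasSize (λ i → y ∈₃ blocks i) β → HasSize (λ c → hole c ≢ grp y) β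
  classesNotMissing-size y (e , e-inj , e-mem , e-onto) = cls ∘ e , cls∘e-inj , cls∘e-mem , cls∘e-onto
    where
    cls∘e-mem : ∀ i → hole (cls (e i)) ≢ grp y
    cls∘e-mem i hole≡ = missHole (cls (e i)) y (sym hole≡) (e i) refl (e-mem i)
    cls∘e-inj : Injective _≡_ _≡_ (cls ∘ e)
    cls∘e-inj {i} {j} same = e-inj (ExactlyOne-unique (parallel (cls (e i)) y (cls∘e-mem i ∘ sym))
                                       (refl , e-mem i) (sym same , e-mem j))
    cls∘e-onto : ∀ c → hole c ≢ grp y → ∃ λ i → cls (e i) ≡ c
    cls∘e-onto c ne = let (j , (cls≡c , y∈) , _) = parallel c y (ne ∘ sym)
                          (i , ei≡j) = e-onto j y∈
                      in i , trans (cong cls ei≡j) cls≡c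

  classCount-split : ∀ {k} y → grp y ≡ k → ∀ {a β} →
                  HasSize (λ c → hole c ≡ k) a → HasSize (λ i → y ∈₃ blocks i) β → a + β ≡ r
  classCount-split y refl missing through =
    HasSize-unique (Enumeration-resp (λ _ _ → tt) (λ c _ → toSum (hole c ≟ grp y))
                     (HasSize-⊎ missing (classesNotMissing-size y through) (λ c ≡ ≢ → ≢ ≡)))
                   (HasSize-universal r)

replication-arithmetic : ∀ g m β → suc g * 2 + β * 2 ≡ suc g * 2 * (2 + m) → β ≡ suc g * suc m
replication-arithmetic g m β e =
  *-cancelʳ-≡ β (suc g * suc m) 2 (+-cancelˡ-≡ (suc g * 2) _ _ (trans e (expand g m)))
  where
  expand : ∀ g m → suc g * 2 * (2 + m) ≡ suc g * 2 + suc g * suc m * 2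
  expand = solve-∀

holeCount-arithmetic : ∀ g m a → a + suc g * suc m ≡ (2 + m) * a → a ≡ suc g
holeCount-arithmetic g m a e =
  sym (*-cancelʳ-≡ (suc g) a (suc m) (trans (+-cancelˡ-≡ a _ _ e) (*-comm (suc m) a)))

-- With groups of size h = 2(g+1), a point lies in (g+1)(u−1) blocks, one in each class not
-- missing its group; so every hole is missed by r − (g+1)(u−1) classes, and as the holes
-- partition the classes, r = u·(r − (g+1)(u−1)).
holeClasses-size : ∀ {g m} (F : KirkmanFrame (suc g * 2) (2 + m) (suc g * 2 * (2 + m))) →
                   ∀ k → HasSize (λ c → KirkmanFrame.hole F c ≡ k) (suc g)
holeClasses-size {g} {m} F k = subst (HasSize _) (trans (a≡a₀ k) a₀≡) (proj₂ (missing k))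
  where
  open KirkmanFrame F
  open GDD gdd
  point : ∀ k → Fin (suc g * 2 * (2 + m))
  point k = proj₁ (grpSize k) zero
  point-grp : ∀ k → grp (point k) ≡ k
  point-grp k = proj₁ (proj₂ (proj₂ (grpSize k))) zero
  missing : ∀ k → ∃ (HasSize (λ c → hole c ≡ k))
  missing k = HasSize-decidable (λ c → hole c ≟ k)
  through : ∀ k → ∃ (HasSize (λ i → point k ∈₃ blocks i))
  through k = HasSize-decidable (λ i → point k ∈₃? blocks i)
  a : Fin (2 + m) → ℕ
  a = proj₁ ∘ missing
  split : ∀ k → a k + suc g * suc m ≡ r
  split k = subst (λ β → a k + β ≡ r)
                  (replication-arithmetic g m _ (GDD-replication gdd (point k) (proj₂ (through k))))
                  (classCount-split F (point k) (point-grp k) (proj₂ (missing k)) (proj₂ (through k)))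
  a≡a₀ : ∀ k → a k ≡ a zero
  a≡a₀ k = +-cancelʳ-≡ _ (a k) (a zero) (trans (split k) (sym (split zero)))
  r≡ : r ≡ (2 + m) * a zero
  r≡ = HasSize-unique (HasSize-universal r)
         (Enumeration-resp (λ _ _ → tt) (λ c _ → hole c , refl)
           (HasSize-Σ (λ k → subst (HasSize _) (a≡a₀ k) (proj₂ (missing k)))
                      (λ k k′ c e e′ → trans (sym e) e′)))
  a₀≡ : a zero ≡ suc g
  a₀≡ = holeCount-arithmetic g m (a zero) (trans (split zero) r≡)

Finite : X ⊎ Y → Set
Finite (inj₁ _) = ⊤
Finite (inj₂ _) = ⊥

InGroup : {Z Y U : Set} → (Z → U) → U → Z ⊎ Y → Set
InGroup grp k (inj₁ x) = grp x ≡ k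
InGroup grp k (inj₂ _) = ⊤

InGroup-unique : {Z Y U : Set} {grp : Z → U} {k k′ : U} {p : Z ⊎ Y} →
                 Finite p → InGroup grp k p → InGroup grp k′ p → k ≡ k′
InGroup-unique {p = inj₁ x} _ x∈k x∈k′ = trans (sym x∈k) x∈k′

∞-triple : Triple (X ⊎ Fin 3)
∞-triple = ⟨ inj₂ zero , inj₂ (suc zero) , inj₂ (suc (suc zero)) ⟩

∞-triple-infinite : {p : X ⊎ Fin 3} → p ∈₃ ∞-triple → ¬ Finite p
∞-triple-infinite (inj₁ refl)        = id
∞-triple-infinite (inj₂ (inj₁ refl)) = id
∞-triple-infinite (inj₂ (inj₂ refl)) = id

∞-triple-∋ : ∀ a → inj₂ {A = X} a ∈₃ ∞-triple
∞-triple-∋ zero             = inj₁ refl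
∞-triple-∋ (suc zero)       = inj₂ (inj₁ refl)
∞-triple-∋ (suc (suc zero)) = inj₂ (inj₂ refl)

FillPoint : ℕ → ℕ → Set
FillPoint g d = (Fin g ⊎ Fin d) ⊎ Fin 3

subPoint : ∀ {g d} → Fin g ⊎ ⊤ → FillPoint g d
subPoint (inj₁ w) = inj₁ (inj₁ w)
subPoint (inj₂ _) = inj₂ zero

-- A KTS(g+d+3) on (W ⊎ D) ⊎ {∞₀,∞₁,∞₂}, |W| = g, |D| = d, with {∞₀,∞₁,∞₂} as a block
-- of a distinguished class, containing a sub-STS(g+1) on W ⊎ {∞₀}.
record Filler (g d s : ℕ) : Set where
  field
    b b′     : ℕ
    kts      : KTSOn (FillPoint g d) (Fin b ⊎ ⊤) (Fin s ⊎ ⊤)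
    ∞-block  : KTSOn.blocks kts (inj₂ tt) ≡ ∞-triple
    ∞-class  : KTSOn.cls kts (inj₂ tt) ≡ inj₂ tt
    sub      : STSOn (Fin g ⊎ ⊤) (Fin b′)
    subBlock : Fin b′ → Fin b
    subBlock-image : ∀ j → KTSOn.blocks kts (inj₁ (subBlock j)) ≡ map₃ subPoint (STSOn.blocks sub j)

module Fill {g d u s : ℕ} (F : KirkmanFrame₂ g (g + d) u)
            (holeClasses : ∀ k → HasSize (λ c → KirkmanFrame.hole (KirkmanFrame₂.frame F) c ≡ k) s)
            (T : Filler g d s) where
  open KirkmanFrame₂ F using (frame; inner)
    renaming (emb to innerEmb; inj to innerEmb-injective; sub to innerEmb-group; isBlk to innerBlock-isBlock)
  open KirkmanFrame frame using (gdd; cls; hole; missHole; parallel)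
  open GDD gdd using (grpSize) renaming (grp to group; b to bF; blocks to frameBlock; pairs to framePairs)
  open GDD inner using ()
    renaming (grp to innerGroup; grpSize to innerGroupSize; b to bI; blocks to innerBlock; pairs to innerPairs)
  open Filler T using (b; b′; ∞-block; ∞-class; sub; subBlock; subBlock-image)
  open KTSOn (Filler.kts T) using ()
    renaming (blocks to fillBlock; cls to fillClass; pairs to fillPairs; parallel to fillParallel;
              distinct to fillDistinct)

  N : ℕ
  N = (g + d) * u

  innerGroupPoint : Fin u → Fin g → Fin (g * u)
  innerGroupPoint k = proj₁ (innerGroupSize k)

  innerGroupPoint-injective : ∀ k → Injective _≡_ _≡_ (innerGroupPoint k)
  innerGroupPoint-injective k = proj₁ (proj₂ (innerGroupSize k))

  innerGroupPoint-group : ∀ k w → innerGroup (innerGroupPoint k w) ≡ k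
  innerGroupPoint-group k = proj₁ (proj₂ (proj₂ (innerGroupSize k)))

  innerGroupPoint-onto : ∀ k y → innerGroup y ≡ k → ∃ λ w → innerGroupPoint k w ≡ y
  innerGroupPoint-onto k = proj₂ (proj₂ (proj₂ (innerGroupSize k)))

  -- The group V_k of the frame splits into the image W_k of the inner group and the rest D_k.
  innerPoint : Fin u → Fin g → Fin N
  innerPoint k = innerEmb ∘ innerGroupPoint k

  innerPoint-injective : ∀ k → Injective _≡_ _≡_ (innerPoint k)
  innerPoint-injective k = innerGroupPoint-injective k ∘ innerEmb-injective

  innerPoint-group : ∀ k w → group (innerPoint k w) ≡ k
  innerPoint-group k w = trans (innerEmb-group _) (innerGroupPoint-group k w)

  IsInner : Fin u → Fin N → Set
  IsInner k x = ∃ λ w → innerPoint k w ≡ x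

  IsOuter : Fin u → Fin N → Set
  IsOuter k x = group x ≡ k × ¬ IsInner k x

  -- Opaque so that ι below does not unfold the counting argument during conversion checks.
  opaque
    outerPoints : ∀ k → HasSize (IsOuter k) d
    outerPoints k with HasSize-decidable (λ x → (group x ≟ k) ×-dec ¬? (any? (λ w → innerPoint k w ≟ x)))
    ... | d′ , outer = subst (HasSize (IsOuter k)) (+-cancelˡ-≡ g d′ d (HasSize-unique whole (grpSize k))) outer
      where
      inner-size : HasSize (IsInner k) g
      inner-size = innerPoint k , innerPoint-injective k , (λ w → w , refl) , (λ _ → id)
      whole : HasSize (λ x → group x ≡ k) (g + d′)
      whole = Enumeration-resp
        (λ x → [ (λ (w , e) → trans (cong group (sym e)) (innerPoint-group k w)) , proj₁ ])
        (λ x e → map₂ (e ,_) (toSum (any? (λ w → innerPoint k w ≟ x))))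
        (HasSize-⊎ inner-size outer (λ x inner (_ , ¬inner) → ¬inner inner))

  outerPoint : Fin u → Fin d → Fin N
  outerPoint k = proj₁ (outerPoints k)

  outerPoint-injective : ∀ k → Injective _≡_ _≡_ (outerPoint k)
  outerPoint-injective k = proj₁ (proj₂ (outerPoints k))

  outerPoint-outer : ∀ k e → IsOuter k (outerPoint k e)
  outerPoint-outer k = proj₁ (proj₂ (proj₂ (outerPoints k)))

  Point : Set
  Point = Fin N ⊎ Fin 3

  Region : Fin u → Point → Set
  Region = InGroup group

  ι : Fin u → FillPoint g d → Point
  ι k = map₁ [ innerPoint k , outerPoint k ]

  ι-region : ∀ k t → Region k (ι k t)
  ι-region k (inj₁ (inj₁ w)) = innerPoint-group k w
  ι-region k (inj₁ (inj₂ e)) = proj₁ (outerPoint-outer k e)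
  ι-region k (inj₂ a)        = tt

  ι-injective : ∀ k → Injective _≡_ _≡_ (ι k)
  ι-injective k {inj₁ (inj₁ w)} {inj₁ (inj₁ w′)} eq = cong (inj₁ ∘ inj₁) (innerPoint-injective k (inj₁-injective eq))
  ι-injective k {inj₁ (inj₁ w)} {inj₁ (inj₂ o′)} eq = ⊥-elim (proj₂ (outerPoint-outer k o′) (w , inj₁-injective eq))
  ι-injective k {inj₁ (inj₂ o)} {inj₁ (inj₁ w′)} eq = ⊥-elim (proj₂ (outerPoint-outer k o) (w′ , sym (inj₁-injective eq)))
  ι-injective k {inj₁ (inj₂ o)} {inj₁ (inj₂ o′)} eq = cong (inj₁ ∘ inj₂) (outerPoint-injective k (inj₁-injective eq))
  ι-injective k {inj₂ a}        {inj₂ a′}        eq = cong inj₂ (inj₂-injective eq)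

  ι-onto : ∀ k p → Region k p → ∃ λ t → ι k t ≡ p
  ι-onto k (inj₂ a) _ = inj₂ a , refl
  ι-onto k (inj₁ x) x∈k with any? (λ w → innerPoint k w ≟ x)
  ... | yes (w , e) = inj₁ (inj₁ w) , cong inj₁ e
  ... | no ¬inner   = let (e , e≡x) = proj₂ (proj₂ (proj₂ (outerPoints k))) x (x∈k , ¬inner)
                      in inj₁ (inj₂ e) , cong inj₁ e≡x

  ι-finite⁻ : ∀ k t → Finite (ι k t) → Finite t
  ι-finite⁻ k (inj₁ _) _ = tt

  fill∞-infinite : ∀ {t} → t ∈₃ fillBlock (inj₂ tt) → ¬ Finite t
  fill∞-infinite {t} m = ∞-triple-infinite (subst (t ∈₃_) ∞-block m)

  fill∞-∋ : ∀ a → inj₂ a ∈₃ fillBlock (inj₂ tt)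
  fill∞-∋ a = subst (inj₂ a ∈₃_) (sym ∞-block) (∞-triple-∋ a)

  Block : Set
  Block = Fin bF ⊎ ((Fin u × Fin b) ⊎ ⊤)

  pattern frameBlk i  = inj₁ i
  pattern holeBlk k j = inj₂ (inj₁ (k , j))
  pattern ∞Blk        = inj₂ (inj₂ tt)

  block : Block → Triple Point
  block (frameBlk i)  = map₃ inj₁ (frameBlock i)
  block (holeBlk k j) = map₃ (ι k) (fillBlock (inj₁ j))
  block ∞Blk          = ∞-triple

  ∈-frameBlock : ∀ {p} i → p ∈₃ block (frameBlk i) → Finite p
  ∈-frameBlock i m with ∈₃-map⁻ inj₁ (frameBlock i) m
  ... | _ , refl , _ = tt

  ∈-filledBlock : ∀ {p} k j → p ∈₃ block (holeBlk k j) → Region k p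
  ∈-filledBlock k j m with ∈₃-map⁻ (ι k) (fillBlock (inj₁ j)) m
  ... | t , refl , _ = ι-region k t

  ι∈filledBlock⇔ : ∀ k j t → ι k t ∈₃ block (holeBlk k j) ⇔ t ∈₃ fillBlock (inj₁ j)
  ι∈filledBlock⇔ k j t = ∈₃-map-injective⇔ (ι-injective k) (fillBlock (inj₁ j))

  frameUnique : {P : Block → Set} → ∃! _≡_ (P ∘ inj₁) →
                (∀ k j → ¬ P (holeBlk k j)) → ¬ P (∞Blk) → ∃! _≡_ P
  frameUnique p ¬filled ¬∞ = ∃!-inj₁ p λ { (inj₁ (k , j)) → ¬filled k j ; (inj₂ tt) → ¬∞ }

  ∞Unique : {P : Block → Set} → P (∞Blk) →
            (∀ i → ¬ P (frameBlk i)) → (∀ k j → ¬ P (holeBlk k j)) → ∃! _≡_ P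
  ∞Unique p∞ ¬frame ¬filled = ∃!-inj₂ (∃!-inj₂ (tt , p∞ , λ _ → refl) (λ (k , j) → ¬filled k j)) ¬frame

  -- Uniqueness in the filling of hole k, away from its ∞-block, lifts to the whole design
  -- once frame blocks, the ∞-block and the other holes are ruled out.
  filledUnique : ∀ k {P : Block → Set} {Q : Fin b ⊎ ⊤ → Set} → ∃! _≡_ Q → ¬ Q (inj₂ tt) →
                 (∀ j → P (holeBlk k j) ⇔ Q (inj₁ j)) →
                 (∀ {k′ j} → P (holeBlk k′ j) → k′ ≡ k) →
                 (∀ i → ¬ P (frameBlk i)) → ¬ P (∞Blk) → ∃! _≡_ P
  filledUnique k q ¬q∞ P⇔Q only-k ¬frame ¬∞ =
    ∃!-inj₂ (∃!-inj₁ (∃!-at k (∃!-⇔ (⇔-sym ∘ P⇔Q) (∃!-inj₁⁻ q λ { tt → ¬q∞ })) only-k) λ { tt → ¬∞ }) ¬frame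

  localPair : ∀ k t t′ → t ≢ t′ → Finite t →
              ∃! _≡_ (λ β → ι k t ∈₃ block β × ι k t′ ∈₃ block β)
  localPair k t t′ t≢t′ fin =
    filledUnique k (fillPairs t t′ t≢t′) (λ (m , _) → fill∞-infinite m fin)
      (λ j → ι∈filledBlock⇔ k j t ×-⇔ ι∈filledBlock⇔ k j t′)
      (λ {k′} {j} (m , _) → InGroup-unique (finite t fin) (∈-filledBlock k′ j m) (ι-region k t))
      ¬frame (λ (m , _) → ∞-triple-infinite m (finite t fin))
    where
    finite : ∀ t → Finite t → Finite (ι k t)
    finite (inj₁ _) _ = tt
    ¬frame : ∀ i → ¬ (ι k t ∈₃ block (frameBlk i) × ι k t′ ∈₃ block (frameBlk i))
    ¬frame i (m , m′) with ∈₃-map⁻ inj₁ _ m | ∈₃-map⁻ inj₁ _ m′ | ι-region k t | ι-region k t′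
    ... | x , x≡ , x∈ | y , y≡ , y∈ | t∈k | t′∈k =
      t≢t′ (ι-injective k (trans (sym x≡) (trans (cong inj₁ same) y≡)))
      where
      same : x ≡ y
      same = inBlock-sameGroup⇒≡ gdd i x∈ y∈
               (trans (subst (Region k) (sym x≡) t∈k) (sym (subst (Region k) (sym y≡) t′∈k)))

  regionPair : ∀ k p q → Finite p → Region k p → Region k q → p ≢ q →
               ∃! _≡_ (λ β → p ∈₃ block β × q ∈₃ block β)
  regionPair k p q fin p∈k q∈k p≢q with ι-onto k p p∈k | ι-onto k q q∈k
  ... | t , refl | t′ , refl = localPair k t t′ (p≢q ∘ cong (ι k)) (ι-finite⁻ k t fin)

  crossPair : ∀ x y → group x ≢ group y → ∃! _≡_ (λ β → inj₁ x ∈₃ block β × inj₁ y ∈₃ block β)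
  crossPair x y x≁y =
    frameUnique (∃!-⇔ (λ i → ⇔-sym (∈₃-map-injective⇔ inj₁-injective _ ×-⇔ ∈₃-map-injective⇔ inj₁-injective _))
                      (ExactlyOne⇒∃! (framePairs x y x≁y)))
      (λ k j (m , m′) → x≁y (trans (∈-filledBlock k j m) (sym (∈-filledBlock k j m′))))
      (λ (m , _) → ∞-triple-infinite m tt)

  ∞Pair : ∀ a a′ → a ≢ a′ → ∃! _≡_ (λ β → inj₂ a ∈₃ block β × inj₂ a′ ∈₃ block β)
  ∞Pair a a′ a≢a′ = ∞Unique (∞-triple-∋ a , ∞-triple-∋ a′) (λ i (m , _) → ∈-frameBlock i m) ¬filled
    where
    ¬filled : ∀ k j → ¬ (inj₂ a ∈₃ block (holeBlk k j) × inj₂ a′ ∈₃ block (holeBlk k j))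
    ¬filled k j (m , m′) with ∃!-unique (fillPairs (inj₂ a) (inj₂ a′) (a≢a′ ∘ inj₂-injective))
                                (Equivalence.to (ι∈filledBlock⇔ k j (inj₂ a)) m ,
                                 Equivalence.to (ι∈filledBlock⇔ k j (inj₂ a′)) m′)
                                (fill∞-∋ a , fill∞-∋ a′)
    ... | ()

  pairs : ∀ p q → p ≢ q → ∃! _≡_ (λ β → p ∈₃ block β × q ∈₃ block β)
  pairs (inj₁ x) (inj₁ y) x≢y with group x ≟ group y
  ... | yes x∼y = regionPair (group x) _ _ tt refl (sym x∼y) x≢y
  ... | no x≁y  = crossPair x y x≁y
  pairs (inj₁ x) (inj₂ a)  p≢q = regionPair (group x) _ _ tt refl tt p≢q
  pairs (inj₂ a) (inj₁ y)  p≢q =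
    ∃!-⇔ (λ _ → mk⇔ swap swap) (regionPair (group y) _ _ tt refl tt (p≢q ∘ sym))
  pairs (inj₂ a) (inj₂ a′) p≢q = ∞Pair a a′ (p≢q ∘ cong inj₂)

  distinct : ∀ β → Distinct₃ (block β)
  distinct (frameBlk i)  = Distinct₃-map inj₁-injective (frameBlock i) (GDD-distinct gdd i)
  distinct (holeBlk k j) = Distinct₃-map (ι-injective k) (fillBlock (inj₁ j)) (fillDistinct (inj₁ j))
  distinct ∞Blk          = (λ ()) , (λ ()) , (λ ())

  filledSTS : STSOn Point Block
  filledSTS = record { blocks = block ; distinct = distinct ; pairs = pairs }

  classOf : Fin u → Fin s → Fin (KirkmanFrame.r frame)
  classOf k = proj₁ (holeClasses k)

  classOf-injective : ∀ k → Injective _≡_ _≡_ (classOf k)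
  classOf-injective k = proj₁ (proj₂ (holeClasses k))

  classOf-hole : ∀ k t → hole (classOf k t) ≡ k
  classOf-hole k = proj₁ (proj₂ (proj₂ (holeClasses k)))

  label : Fin (KirkmanFrame.r frame) → Fin s
  label c = proj₁ (proj₂ (proj₂ (proj₂ (holeClasses (hole c)))) c refl)

  classOf-label : ∀ c → classOf (hole c) (label c) ≡ c
  classOf-label c = proj₂ (proj₂ (proj₂ (proj₂ (holeClasses (hole c)))) c refl)

  label-classOf : ∀ k t → label (classOf k t) ≡ t
  label-classOf k t = classOf-injective k
    (subst (λ k′ → classOf k′ (label (classOf k t)) ≡ classOf k t)
           (classOf-hole k t) (classOf-label (classOf k t)))

  Class : Set
  Class = (Fin u × Fin s) ⊎ ⊤

  classAt : Fin u → Fin s ⊎ ⊤ → Class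
  classAt k = map₁ (k ,_)

  classAt-injective : ∀ k → Injective _≡_ _≡_ (classAt k)
  classAt-injective k {inj₁ _} {inj₁ _} refl = refl
  classAt-injective k {inj₂ _} {inj₂ _} refl = refl

  classAt-hole : ∀ {k k′} c {t} → classAt k′ c ≡ inj₁ (k , t) → k′ ≡ k
  classAt-hole (inj₁ _) refl = refl

  -- Class (k , t) is the t-th frame class missing V_k together with class t of the filling
  -- of V_k; class inj₂ tt collects the remaining class of every filling and the ∞-block.
  class : Block → Class
  class (frameBlk i)  = inj₁ (hole (cls i) , label (cls i))
  class (holeBlk k j) = classAt k (fillClass (inj₁ j))
  class ∞Blk          = inj₂ tt

  frameClass⇔ : ∀ i k t → class (frameBlk i) ≡ inj₁ (k , t) ⇔ cls i ≡ classOf k t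
  frameClass⇔ i k t = mk⇔
    (λ e → let (hole≡ , label≡) = ,-injective (inj₁-injective e)
           in trans (sym (classOf-label (cls i))) (cong₂ classOf hole≡ label≡))
    (λ e → cong inj₁ (cong₂ _,_ (trans (cong hole e) (classOf-hole k t))
                                (trans (cong label e) (label-classOf k t))))

  classAt⇔ : ∀ k {c c′} → classAt k c ≡ classAt k c′ ⇔ c ≡ c′
  classAt⇔ k = mk⇔ (classAt-injective k) (cong (classAt k))

  regionClass : ∀ k t p → Region k p → ∃! _≡_ (λ β → class β ≡ inj₁ (k , t) × p ∈₃ block β)
  regionClass k t p p∈k with ι-onto k p p∈k
  ... | tp , refl =
    filledUnique k (fillParallel (inj₁ t) tp) (λ (e , _) → inj₂≢inj₁ (trans (sym ∞-class) e))
      (λ j → classAt⇔ k ×-⇔ ι∈filledBlock⇔ k j tp) (λ {_} {j} (e , _) → classAt-hole (fillClass (inj₁ j)) e)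
      ¬frame (λ ())
    where
    inj₂≢inj₁ : ∀ {c : ⊤} {t′ : Fin s} → inj₂ c ≢ inj₁ t′
    inj₂≢inj₁ ()
    ¬frame : ∀ i → ¬ (class (frameBlk i) ≡ inj₁ (k , t) × ι k tp ∈₃ block (frameBlk i))
    ¬frame i (e , m) with ∈₃-map⁻ inj₁ (frameBlock i) m
    ... | x , x≡ , x∈ = missHole (cls i) x (trans (subst (Region k) (sym x≡) (ι-region k tp))
                          (sym (,-injectiveˡ (inj₁-injective e)))) i refl x∈

  frameClass : ∀ k t x → group x ≢ k → ∃! _≡_ (λ β → class β ≡ inj₁ (k , t) × inj₁ x ∈₃ block β)
  frameClass k t x x∉k =
    frameUnique (∃!-⇔ (λ i → ⇔-sym (frameClass⇔ i k t ×-⇔ ∈₃-map-injective⇔ inj₁-injective (frameBlock i)))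
                      (ExactlyOne⇒∃! (parallel (classOf k t) x (x∉k ∘ λ e → trans e (classOf-hole k t)))))
      (λ k′ j (e , m) → x∉k (subst (group x ≡_) (classAt-hole (fillClass (inj₁ j)) e) (∈-filledBlock k′ j m)))
      (λ ())

  ∞ClassFinite : ∀ k p → Finite p → Region k p → ∃! _≡_ (λ β → class β ≡ inj₂ tt × p ∈₃ block β)
  ∞ClassFinite k p fin p∈k with ι-onto k p p∈k
  ... | tp , refl =
    filledUnique k (fillParallel (inj₂ tt) tp) (λ (_ , m) → fill∞-infinite m (ι-finite⁻ k tp fin))
      (λ j → classAt⇔ k ×-⇔ ι∈filledBlock⇔ k j tp)
      (λ {k′} {j} (_ , m) → InGroup-unique fin (∈-filledBlock k′ j m) (ι-region k tp))
      (λ { _ (() , _) }) (λ (_ , m) → ∞-triple-infinite m fin)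

  ∞ClassInfinite : ∀ a → ∃! _≡_ (λ β → class β ≡ inj₂ tt × inj₂ a ∈₃ block β)
  ∞ClassInfinite a = ∞Unique (refl , ∞-triple-∋ a) (λ { _ (() , _) }) ¬filled
    where
    ¬filled : ∀ k j → ¬ (class (holeBlk k j) ≡ inj₂ tt × inj₂ a ∈₃ block (holeBlk k j))
    ¬filled k j (e , m) with ∃!-unique (fillParallel (inj₂ tt) (inj₂ a))
                                (classAt-injective k e , Equivalence.to (ι∈filledBlock⇔ k j (inj₂ a)) m)
                                (∞-class , fill∞-∋ a)
    ... | ()

  parallelClass : ∀ c p → ∃! _≡_ (λ β → class β ≡ c × p ∈₃ block β)
  parallelClass (inj₁ (k , t)) (inj₁ x) with group x ≟ k
  ... | yes x∈k = regionClass k t (inj₁ x) x∈k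
  ... | no x∉k  = frameClass k t x x∉k
  parallelClass (inj₁ (k , t)) (inj₂ a) = regionClass k t (inj₂ a) tt
  parallelClass (inj₂ tt)      (inj₁ x) = ∞ClassFinite (group x) (inj₁ x) tt refl
  parallelClass (inj₂ tt)      (inj₂ a) = ∞ClassInfinite a

  filledKTS : KTSOn Point Block Class
  filledKTS = record { sts = filledSTS ; cls = class ; parallel = parallelClass }

  SubPoint : Set
  SubPoint = Fin (g * u) ⊎ ⊤

  embSub : SubPoint → Point
  embSub (inj₁ y) = inj₁ (innerEmb y)
  embSub (inj₂ _) = inj₂ zero

  embSub-injective : Injective _≡_ _≡_ embSub
  embSub-injective {inj₁ _} {inj₁ _} e = cong inj₁ (innerEmb-injective (inj₁-injective e))
  embSub-injective {inj₂ _} {inj₂ _} _ = refl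

  SubRegion : Fin u → SubPoint → Set
  SubRegion = InGroup innerGroup

  κ : Fin u → Fin g ⊎ ⊤ → SubPoint
  κ k = map₁ (innerGroupPoint k)

  κ-region : ∀ k z → SubRegion k (κ k z)
  κ-region k (inj₁ w) = innerGroupPoint-group k w
  κ-region k (inj₂ _) = tt

  κ-injective : ∀ k → Injective _≡_ _≡_ (κ k)
  κ-injective k {inj₁ _} {inj₁ _} e = cong inj₁ (innerGroupPoint-injective k (inj₁-injective e))
  κ-injective k {inj₂ _} {inj₂ _} _ = refl

  κ-onto : ∀ k q → SubRegion k q → ∃ λ z → κ k z ≡ q
  κ-onto k (inj₁ y) y∈k = let (w , e) = innerGroupPoint-onto k y y∈k in inj₁ w , cong inj₁ e
  κ-onto k (inj₂ _) _   = inj₂ tt , refl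

  ι∘subPoint : ∀ k z → ι k (subPoint z) ≡ embSub (κ k z)
  ι∘subPoint k (inj₁ _) = refl
  ι∘subPoint k (inj₂ _) = refl

  SubBlock : Set
  SubBlock = Fin bI ⊎ (Fin u × Fin b′)

  subBlockAt : SubBlock → Triple SubPoint
  subBlockAt (inj₁ i)       = map₃ inj₁ (innerBlock i)
  subBlockAt (inj₂ (k , j)) = map₃ (κ k) (STSOn.blocks sub j)

  ∈-localSubBlock : ∀ {q} k j → q ∈₃ subBlockAt (inj₂ (k , j)) → SubRegion k q
  ∈-localSubBlock k j m with ∈₃-map⁻ (κ k) (STSOn.blocks sub j) m
  ... | z , refl , _ = κ-region k z

  localSubPair : ∀ k z z′ → z ≢ z′ → Finite z →
                 ∃! _≡_ (λ β → κ k z ∈₃ subBlockAt β × κ k z′ ∈₃ subBlockAt β)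
  localSubPair k z z′ z≢z′ fin =
    ∃!-inj₂ (∃!-at k (∃!-⇔ (λ j → ⇔-sym (κ∈ j z ×-⇔ κ∈ j z′)) (STSOn.pairs sub z z′ z≢z′))
                     (λ {k′} {j} (m , _) → InGroup-unique (finite z fin) (∈-localSubBlock k′ j m) (κ-region k z)))
            ¬inner
    where
    κ∈ : ∀ j z → κ k z ∈₃ subBlockAt (inj₂ (k , j)) ⇔ z ∈₃ STSOn.blocks sub j
    κ∈ j z = ∈₃-map-injective⇔ (κ-injective k) (STSOn.blocks sub j)
    finite : ∀ z → Finite z → Finite (κ k z)
    finite (inj₁ _) _ = tt
    ¬inner : ∀ i → ¬ (κ k z ∈₃ subBlockAt (inj₁ i) × κ k z′ ∈₃ subBlockAt (inj₁ i))
    ¬inner i (m , m′) with ∈₃-map⁻ inj₁ (innerBlock i) m | ∈₃-map⁻ inj₁ (innerBlock i) m′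
    ... | y , y≡ , y∈ | y′ , y′≡ , y′∈ =
      z≢z′ (κ-injective k (trans (sym y≡) (trans (cong inj₁ same) y′≡)))
      where
      same : y ≡ y′
      same = inBlock-sameGroup⇒≡ inner i y∈ y′∈
               (trans (subst (SubRegion k) (sym y≡) (κ-region k z))
                      (sym (subst (SubRegion k) (sym y′≡) (κ-region k z′))))

  subRegionPair : ∀ k q q′ → Finite q → SubRegion k q → SubRegion k q′ → q ≢ q′ →
                  ∃! _≡_ (λ β → q ∈₃ subBlockAt β × q′ ∈₃ subBlockAt β)
  subRegionPair k q q′ fin q∈k q′∈k q≢q′ with κ-onto k q q∈k | κ-onto k q′ q′∈k
  ... | z , refl | z′ , refl = localSubPair k z z′ (q≢q′ ∘ cong (κ k)) (κ-finite⁻ z fin)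
    where
    κ-finite⁻ : ∀ z → Finite (κ k z) → Finite z
    κ-finite⁻ (inj₁ _) _ = tt

  innerCrossPair : ∀ y y′ → innerGroup y ≢ innerGroup y′ →
                   ∃! _≡_ (λ β → inj₁ y ∈₃ subBlockAt β × inj₁ y′ ∈₃ subBlockAt β)
  innerCrossPair y y′ y≁y′ =
    ∃!-inj₁ (∃!-⇔ (λ i → ⇔-sym (∈₃-map-injective⇔ inj₁-injective (innerBlock i) ×-⇔
                                 ∈₃-map-injective⇔ inj₁-injective (innerBlock i)))
                  (ExactlyOne⇒∃! (innerPairs y y′ y≁y′)))
            (λ (k , j) (m , m′) → y≁y′ (trans (∈-localSubBlock k j m) (sym (∈-localSubBlock k j m′))))

  subPairs : ∀ q q′ → q ≢ q′ → ∃! _≡_ (λ β → q ∈₃ subBlockAt β × q′ ∈₃ subBlockAt β)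
  subPairs (inj₁ y) (inj₁ y′) q≢q′ with innerGroup y ≟ innerGroup y′
  ... | yes y∼y′ = subRegionPair (innerGroup y) _ _ tt refl (sym y∼y′) q≢q′
  ... | no y≁y′  = innerCrossPair y y′ y≁y′
  subPairs (inj₁ y) (inj₂ _)  q≢q′ = subRegionPair (innerGroup y) _ _ tt refl tt q≢q′
  subPairs (inj₂ _) (inj₁ y′) q≢q′ =
    ∃!-⇔ (λ _ → mk⇔ swap swap) (subRegionPair (innerGroup y′) _ _ tt refl tt (q≢q′ ∘ sym))
  subPairs (inj₂ _) (inj₂ _)  q≢q′ = ⊥-elim (q≢q′ refl)

  subDistinct : ∀ β → Distinct₃ (subBlockAt β)
  subDistinct (inj₁ i)       = Distinct₃-map inj₁-injective (innerBlock i) (GDD-distinct inner i)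
  subDistinct (inj₂ (k , j)) = Distinct₃-map (κ-injective k) (STSOn.blocks sub j) (STSOn.distinct sub j)

  filledSubSTS : STSOn SubPoint SubBlock
  filledSubSTS = record { blocks = subBlockAt ; distinct = subDistinct ; pairs = subPairs }

  isBlock : ∀ β → Σ Block λ β′ → ∀ p →
            p ∈₃ block β′ ⇔ (∃ λ q → embSub q ≡ p × q ∈₃ subBlockAt β)
  isBlock (inj₁ j) = let (i , image) = innerBlock-isBlock j in frameBlk i , λ p → mk⇔ (to i image) (from i image)
    where
    Image : Fin bF → Set
    Image i = ∀ x → x ∈₃ frameBlock i ⇔ (∃ λ y → innerEmb y ≡ x × y ∈₃ innerBlock j)
    to : ∀ i → Image i → ∀ {p} → p ∈₃ block (frameBlk i) → ∃ λ q → embSub q ≡ p × q ∈₃ subBlockAt (inj₁ j)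
    to i image m with ∈₃-map⁻ inj₁ (frameBlock i) m
    ... | x , refl , x∈ = let (y , y≡ , y∈) = Equivalence.to (image x) x∈
                          in inj₁ y , cong inj₁ y≡ , ∈₃-map⁺ inj₁ (innerBlock j) y∈
    from : ∀ i → Image i → ∀ {p} → (∃ λ q → embSub q ≡ p × q ∈₃ subBlockAt (inj₁ j)) → p ∈₃ block (frameBlk i)
    from i image (q , refl , m) with ∈₃-map⁻ inj₁ (innerBlock j) m
    ... | y , refl , y∈ = ∈₃-map⁺ inj₁ (frameBlock i) (Equivalence.from (image (innerEmb y)) (y , refl , y∈))
  isBlock (inj₂ (k , j)) = holeBlk k (subBlock j) , λ p →
    subst (λ t → p ∈₃ t ⇔ (∃ λ q → embSub q ≡ p × q ∈₃ subBlockAt (inj₂ (k , j))))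
          (sym image) (∈₃-map⇔ embSub (subBlockAt (inj₂ (k , j))))
    where
    image : block (holeBlk k (subBlock j)) ≡ map₃ embSub (subBlockAt (inj₂ (k , j)))
    image = trans (cong (map₃ (ι k)) (subBlock-image j)) (map₃-cong (ι∘subPoint k) (STSOn.blocks sub j))

  filledSubdesign : SubdesignOn filledSTS SubPoint SubBlock
  filledSubdesign = record { sub = filledSubSTS ; emb = embSub ; inj = embSub-injective ; isBlk = isBlock }

allᵇ : ∀ {n} → (Fin n → Bool) → Bool
allᵇ {zero}  f = true
allᵇ {suc n} f = f zero ∧ allᵇ (λ i → f (suc i))

allᵇ-sound : ∀ {n} (f : Fin n → Bool) → T (allᵇ f) → ∀ i → T (f i)
allᵇ-sound {suc n} f h zero    = proj₁ (Equivalence.to T-∧ h)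
allᵇ-sound {suc n} f h (suc i) = allᵇ-sound (λ i → f (suc i)) (proj₂ (Equivalence.to T-∧ h)) i

does-true : {P : Set} (d : Dec P) → T (does d) → P
does-true (yes p) _ = p

does-false : {P : Set} (d : Dec P) → T (not (does d)) → ¬ P
does-false (no ¬p) _ = ¬p

exactlyOneᵇ : ∀ {n} → (Fin n → Bool) → Bool
exactlyOneᵇ {zero}  f = false
exactlyOneᵇ {suc n} f = if f zero then allᵇ (λ i → not (f (suc i))) else exactlyOneᵇ (λ i → f (suc i))

exactlyOneᵇ-sound : ∀ {n} {P : Fin n → Set} (P? : Decidable P) → T (exactlyOneᵇ (does ∘ P?)) → ∃! _≡_ P
exactlyOneᵇ-sound {suc n} P? h with P? zero
... | yes p0 = zero , p0 , λ
  { {zero}  _  → refl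
  ; {suc i} pi → ⊥-elim (does-false (P? (suc i)) (allᵇ-sound (λ i → not (does (P? (suc i)))) h i) pi) }
... | no ¬p0 = let (i , pi , unique) = exactlyOneᵇ-sound (λ i → P? (suc i)) h in suc i , pi , λ
  { {zero}  p0 → ⊥-elim (¬p0 p0)
  ; {suc j} pj → cong suc (unique pj) }

module _ {v b : ℕ} (bl : Fin b → Triple (Fin v)) where

  distinct? : ∀ i → Dec (Distinct₃ (bl i))
  distinct? i =
    ¬? (fst (bl i) ≟ snd (bl i)) ×-dec ¬? (fst (bl i) ≟ thd (bl i)) ×-dec ¬? (snd (bl i) ≟ thd (bl i))

  distinctᵇ : Bool
  distinctᵇ = allᵇ (λ i → does (distinct? i))

  distinctᵇ-sound : T distinctᵇ → ∀ i → Distinct₃ (bl i)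
  distinctᵇ-sound h i = does-true (distinct? i) (allᵇ-sound _ h i)

  pair? : ∀ x y i → Dec (x ∈₃ bl i × y ∈₃ bl i)
  pair? x y i = (x ∈₃? bl i) ×-dec (y ∈₃? bl i)

  pairsᵇ : Bool
  pairsᵇ = allᵇ λ x → allᵇ λ y → does (x ≟ y) ∨ exactlyOneᵇ (λ i → does (pair? x y i))

  pairsᵇ-sound : T pairsᵇ → ∀ x y → ¬ x ≡ y → ∃! _≡_ (λ i → x ∈₃ bl i × y ∈₃ bl i)
  pairsᵇ-sound h x y x≢y with Equivalence.to T-∨ (allᵇ-sound _ (allᵇ-sound _ h x) y)
  ... | inj₁ x≡y = ⊥-elim (x≢y (does-true (x ≟ y) x≡y))
  ... | inj₂ one = exactlyOneᵇ-sound (pair? x y) one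

  module _ {r : ℕ} (cl : Fin b → Fin r) where

    member? : ∀ c x i → Dec (cl i ≡ c × x ∈₃ bl i)
    member? c x i = (cl i ≟ c) ×-dec (x ∈₃? bl i)

    parallelᵇ : Bool
    parallelᵇ = allᵇ λ c → allᵇ λ x → exactlyOneᵇ (λ i → does (member? c x i))

    parallelᵇ-sound : T parallelᵇ → ∀ c x → ∃! _≡_ (λ i → cl i ≡ c × x ∈₃ bl i)
    parallelᵇ-sound h c x = exactlyOneᵇ-sound (member? c x) (allᵇ-sound _ (allᵇ-sound _ h c) x)

Triple-≟ : {X : Set} → DecidableEquality X → DecidableEquality (Triple X)
Triple-≟ _≟ₓ_ ⟨ a , b , c ⟩ ⟨ a′ , b′ , c′ ⟩ =
  map′ (λ { (refl , refl , refl) → refl }) (λ { refl → refl , refl , refl })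
       ((a ≟ₓ a′) ×-dec (b ≟ₓ b′) ×-dec (c ≟ₓ c′))

pointIso : Fin 27 ↔ FillPoint 12 12
pointIso = ↔-sym (⊎↔Fin (⊎↔Fin ↔-refl ↔-refl) ↔-refl)

lastIso : ∀ n → Fin (n + 1) ↔ (Fin n ⊎ ⊤)
lastIso n = ↔-sym (⊎↔Fin ↔-refl ⊤↔Fin1)

_≟ᶠ_ : DecidableEquality (FillPoint 12 12)
_≟ᶠ_ = ≡-dec (≡-dec _≟_ _≟_) _≟_

-- Under pointIso the points 0–11 form W, 12–23 form D and 24 + a is ∞ₐ; block 116 is the
-- ∞-block and class 12 its class. The sub-STS(13) lives on 0–12, with 12 ↦ ∞₀.
-- The certificates are passed as _ rather than tt: Agda then solves them by evaluating the
-- Boolean check, whereas checking tt against T (…) is far slower.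
abstract
  blocks₂₇ : Vec (Triple (Fin 27)) 117
  blocks₂₇ = ⟨ # 1 , # 2 , # 5 ⟩ ∷ ⟨ # 4 , # 10 , # 24 ⟩ ∷ ⟨ # 3 , # 13 , # 14 ⟩ ∷ ⟨ # 6 , # 21 , # 26 ⟩ ∷ ⟨ # 7 , # 23 , # 25 ⟩ ∷ ⟨ # 8 , # 18 , # 22 ⟩ ∷ ⟨ # 9 , # 15 , # 17 ⟩ ∷ ⟨ # 11 , # 16 , # 20 ⟩ ∷ ⟨ # 0 , # 12 , # 19 ⟩ ∷ ⟨ # 2 , # 3 , # 24 ⟩ ∷ ⟨ # 5 , # 6 , # 11 ⟩ ∷ ⟨ # 4 , # 14 , # 15 ⟩ ∷ ⟨ # 7 , # 22 , # 26 ⟩ ∷ ⟨ # 8 , # 12 , # 21 ⟩ ∷ ⟨ # 9 , # 19 , # 23 ⟩ ∷ ⟨ # 10 , # 16 , # 18 ⟩ ∷ ⟨ # 0 , # 17 , # 25 ⟩ ∷ ⟨ # 1 , # 13 , # 20 ⟩ ∷ ⟨ # 3 , # 4 , # 6 ⟩ ∷ ⟨ # 0 , # 7 , # 24 ⟩ ∷ ⟨ # 5 , # 15 , # 16 ⟩ ∷ ⟨ # 8 , # 23 , # 26 ⟩ ∷ ⟨ # 9 , # 13 , # 22 ⟩ ∷ ⟨ # 10 , # 12 , # 20 ⟩ ∷ ⟨ # 11 , # 17 , # 19 ⟩ ∷ ⟨ # 1 , # 18 , # 21 ⟩ ∷ ⟨ # 2 , # 14 , # 25 ⟩ ∷ ⟨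 # 4 , # 5 , # 7 ⟩ ∷ ⟨ # 1 , # 6 , # 8 ⟩ ∷ ⟨ # 16 , # 17 , # 24 ⟩ ∷ ⟨ # 9 , # 12 , # 26 ⟩ ∷ ⟨ # 10 , # 14 , # 23 ⟩ ∷ ⟨ # 11 , # 13 , # 25 ⟩ ∷ ⟨ # 0 , # 18 , # 20 ⟩ ∷ ⟨ # 2 , # 19 , # 22 ⟩ ∷ ⟨ # 3 , # 15 , # 21 ⟩ ∷ ⟨ # 5 , # 8 , # 24 ⟩ ∷ ⟨ # 2 , # 7 , # 9 ⟩ ∷ ⟨ # 6 , # 17 , # 18 ⟩ ∷ ⟨ # 10 , # 13 , # 26 ⟩ ∷ ⟨ # 11 , # 12 , # 15 ⟩ ∷ ⟨ # 0 , # 14 , # 21 ⟩ ∷ ⟨ # 1 , # 19 , # 25 ⟩ ∷ ⟨ # 3 , # 20 , # 23 ⟩ ∷ ⟨ # 4 , # 16 , # 22 ⟩ ∷ ⟨ # 6 , # 9 , # 24 ⟩ ∷ ⟨ # 3 , # 8 , # 10 ⟩ ∷ ⟨ # 7 , # 18 , # 19 ⟩ ∷ ⟨ # 11 , # 14 , # 26 ⟩ ∷ ⟨ # 0 , # 13 , # 16 ⟩ ∷ ⟨ # 1 , # 15 , # 22 ⟩ ∷ ⟨ # 2 , # 20 , # 21 ⟩ ∷ ⟨ # 4 , # 12 , # 25 ⟩ ∷ ⟨ # 5 , # 17 , # 23 ⟩ ∷ ⟨ # 6 , # 7 , # 10 ⟩ ∷ ⟨ # 4 , # 9 , # 11 ⟩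 ∷ ⟨ # 8 , # 19 , # 20 ⟩ ∷ ⟨ # 0 , # 15 , # 26 ⟩ ∷ ⟨ # 1 , # 14 , # 17 ⟩ ∷ ⟨ # 2 , # 16 , # 23 ⟩ ∷ ⟨ # 3 , # 22 , # 25 ⟩ ∷ ⟨ # 5 , # 13 , # 21 ⟩ ∷ ⟨ # 12 , # 18 , # 24 ⟩ ∷ ⟨ # 7 , # 8 , # 11 ⟩ ∷ ⟨ # 0 , # 5 , # 10 ⟩ ∷ ⟨ # 9 , # 20 , # 25 ⟩ ∷ ⟨ # 1 , # 16 , # 26 ⟩ ∷ ⟨ # 2 , # 15 , # 18 ⟩ ∷ ⟨ # 3 , # 12 , # 17 ⟩ ∷ ⟨ # 4 , # 21 , # 23 ⟩ ∷ ⟨ # 14 , # 22 , # 24 ⟩ ∷ ⟨ # 6 , # 13 , # 19 ⟩ ∷ ⟨ # 0 , # 8 , # 9 ⟩ ∷ ⟨ # 1 , # 11 , # 24 ⟩ ∷ ⟨ # 10 , # 21 , # 25 ⟩ ∷ ⟨ # 2 , # 17 , # 26 ⟩ ∷ ⟨ # 3 , # 16 , # 19 ⟩ ∷ ⟨ # 4 , # 13 , # 18 ⟩ ∷ ⟨ # 5 , # 12 , # 22 ⟩ ∷ ⟨ # 6 , # 15 , # 23 ⟩ ∷ ⟨ # 7 , # 14 , # 20 ⟩ ∷ ⟨ # 1 , # 9 , # 10 ⟩ ∷ ⟨ # 0 , # 2 , # 6 ⟩ ∷ ⟨ # 11 , # 21 , # 22 ⟩ ∷ ⟨ # 3 ,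 # 18 , # 26 ⟩ ∷ ⟨ # 4 , # 17 , # 20 ⟩ ∷ ⟨ # 5 , # 14 , # 19 ⟩ ∷ ⟨ # 13 , # 23 , # 24 ⟩ ∷ ⟨ # 7 , # 12 , # 16 ⟩ ∷ ⟨ # 8 , # 15 , # 25 ⟩ ∷ ⟨ # 2 , # 10 , # 11 ⟩ ∷ ⟨ # 1 , # 3 , # 7 ⟩ ∷ ⟨ # 0 , # 22 , # 23 ⟩ ∷ ⟨ # 4 , # 19 , # 26 ⟩ ∷ ⟨ # 5 , # 18 , # 25 ⟩ ∷ ⟨ # 15 , # 20 , # 24 ⟩ ∷ ⟨ # 6 , # 12 , # 14 ⟩ ∷ ⟨ # 8 , # 13 , # 17 ⟩ ∷ ⟨ # 9 , # 16 , # 21 ⟩ ∷ ⟨ # 0 , # 3 , # 11 ⟩ ∷ ⟨ # 2 , # 4 , # 8 ⟩ ∷ ⟨ # 1 , # 12 , # 23 ⟩ ∷ ⟨ # 5 , # 20 , # 26 ⟩ ∷ ⟨ # 19 , # 21 , # 24 ⟩ ∷ ⟨ # 6 , # 16 , # 25 ⟩ ∷ ⟨ # 7 , # 13 , # 15 ⟩ ∷ ⟨ # 9 , # 14 , # 18 ⟩ ∷ ⟨ # 10 , # 17 , # 22 ⟩ ∷ ⟨ # 0 , # 1 , # 4 ⟩ ∷ ⟨ # 3 , # 5 , # 9 ⟩ ∷ ⟨ # 2 , # 12 , # 13 ⟩ ∷ ⟨ # 6 , # 20 , # 22 ⟩ ∷ ⟨ # 7 , # 17 , # 21 ⟩ ∷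 ⟨ # 8 , # 14 , # 16 ⟩ ∷ ⟨ # 10 , # 15 , # 19 ⟩ ∷ ⟨ # 11 , # 18 , # 23 ⟩ ∷ ⟨ # 24 , # 25 , # 26 ⟩ ∷ []
  classes₂₇ : Vec (Fin 13) 117
  classes₂₇ = # 0 ∷ # 0 ∷ # 0 ∷ # 0 ∷ # 0 ∷ # 0 ∷ # 0 ∷ # 0 ∷ # 0 ∷ # 1 ∷ # 1 ∷ # 1 ∷ # 1 ∷ # 1 ∷ # 1 ∷ # 1 ∷ # 1 ∷ # 1 ∷ # 2 ∷ # 2 ∷ # 2 ∷ # 2 ∷ # 2 ∷ # 2 ∷ # 2 ∷ # 2 ∷ # 2 ∷ # 3 ∷ # 3 ∷ # 3 ∷ # 3 ∷ # 3 ∷ # 3 ∷ # 3 ∷ # 3 ∷ # 3 ∷ # 4 ∷ # 4 ∷ # 4 ∷ # 4 ∷ # 4 ∷ # 4 ∷ # 4 ∷ # 4 ∷ # 4 ∷ # 5 ∷ # 5 ∷ # 5 ∷ # 5 ∷ # 5 ∷ # 5 ∷ # 5 ∷ # 5 ∷ # 5 ∷ # 6 ∷ # 6 ∷ # 6 ∷ # 6 ∷ # 6 ∷ # 6 ∷ # 6 ∷ # 6 ∷ # 6 ∷ # 7 ∷ # 7 ∷ # 7 ∷ # 7 ∷ # 7 ∷ # 7 ∷ # 7 ∷ # 7 ∷ # 7 ∷ # 8 ∷ # 8 ∷ # 8 ∷ # 8 ∷ # 8 ∷ # 8 ∷ # 8 ∷ # 8 ∷ # 8 ∷ # 9 ∷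 # 9 ∷ # 9 ∷ # 9 ∷ # 9 ∷ # 9 ∷ # 9 ∷ # 9 ∷ # 9 ∷ # 10 ∷ # 10 ∷ # 10 ∷ # 10 ∷ # 10 ∷ # 10 ∷ # 10 ∷ # 10 ∷ # 10 ∷ # 11 ∷ # 11 ∷ # 11 ∷ # 11 ∷ # 11 ∷ # 11 ∷ # 11 ∷ # 11 ∷ # 11 ∷ # 12 ∷ # 12 ∷ # 12 ∷ # 12 ∷ # 12 ∷ # 12 ∷ # 12 ∷ # 12 ∷ # 12 ∷ []
  subBlocks₁₃ : Vec (Triple (Fin 13)) 26
  subBlocks₁₃ = ⟨ # 1 , # 2 , # 5 ⟩ ∷ ⟨ # 4 , # 10 , # 12 ⟩ ∷ ⟨ # 2 , # 3 , # 12 ⟩ ∷ ⟨ # 5 , # 6 , # 11 ⟩ ∷ ⟨ # 3 , # 4 , # 6 ⟩ ∷ ⟨ # 0 , # 7 , # 12 ⟩ ∷ ⟨ # 4 , # 5 , # 7 ⟩ ∷ ⟨ # 1 , # 6 , # 8 ⟩ ∷ ⟨ # 5 , # 8 , # 12 ⟩ ∷ ⟨ # 2 , # 7 , # 9 ⟩ ∷ ⟨ # 6 , # 9 , # 12 ⟩ ∷ ⟨ # 3 , # 8 , # 10 ⟩ ∷ ⟨ # 6 , # 7 , # 10 ⟩ ∷ ⟨ # 4 , # 9 , # 11 ⟩ ∷ ⟨ # 7 , # 8 , # 11 ⟩ ∷ ⟨ # 0 , # 5 , # 10 ⟩ ∷ ⟨ # 0 , # 8 , # 9 ⟩ ∷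 ⟨ # 1 , # 11 , # 12 ⟩ ∷ ⟨ # 1 , # 9 , # 10 ⟩ ∷ ⟨ # 0 , # 2 , # 6 ⟩ ∷ ⟨ # 2 , # 10 , # 11 ⟩ ∷ ⟨ # 1 , # 3 , # 7 ⟩ ∷ ⟨ # 0 , # 3 , # 11 ⟩ ∷ ⟨ # 2 , # 4 , # 8 ⟩ ∷ ⟨ # 0 , # 1 , # 4 ⟩ ∷ ⟨ # 3 , # 5 , # 9 ⟩ ∷ []
  subBlockIndex : Vec (Fin 116) 26
  subBlockIndex = # 0 ∷ # 1 ∷ # 9 ∷ # 10 ∷ # 18 ∷ # 19 ∷ # 27 ∷ # 28 ∷ # 36 ∷ # 37 ∷ # 45 ∷ # 46 ∷ # 54 ∷ # 55 ∷ # 63 ∷ # 64 ∷ # 72 ∷ # 73 ∷ # 81 ∷ # 82 ∷ # 90 ∷ # 91 ∷ # 99 ∷ # 100 ∷ # 108 ∷ # 109 ∷ []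

  template : KTSOn (Fin 27) (Fin 117) (Fin 13)
  template = record
    { sts      = record { blocks   = lookup blocks₂₇
                        ; distinct = distinctᵇ-sound (lookup blocks₂₇) _
                        ; pairs    = pairsᵇ-sound (lookup blocks₂₇) _ }
    ; cls      = lookup classes₂₇
    ; parallel = parallelᵇ-sound (lookup blocks₂₇) (lookup classes₂₇) _ }

  templateSub : STSOn (Fin 13) (Fin 26)
  templateSub = record
    { blocks   = lookup subBlocks₁₃
    ; distinct = distinctᵇ-sound (lookup subBlocks₁₃) _
    ; pairs    = pairsᵇ-sound (lookup subBlocks₁₃) _ }

  fillerKTS : KTSOn (FillPoint 12 12) (Fin 116 ⊎ ⊤) (Fin 12 ⊎ ⊤)
  fillerKTS = KTSOn-transport pointIso (lastIso 116) (lastIso 12) template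

  fillerSub : STSOn (Fin 12 ⊎ ⊤) (Fin 26)
  fillerSub = STSOn-transport (lastIso 12) ↔-refl templateSub

  subBlock-image : ∀ j → KTSOn.blocks fillerKTS (inj₁ (lookup subBlockIndex j)) ≡
                         map₃ subPoint (STSOn.blocks fillerSub j)
  subBlock-image j = does-true (same? j) (allᵇ-sound (λ j → does (same? j)) _ j)
    where
    same? : ∀ j → Dec (KTSOn.blocks fillerKTS (inj₁ (lookup subBlockIndex j)) ≡
                        map₃ subPoint (STSOn.blocks fillerSub j))
    same? j = Triple-≟ _≟ᶠ_ (KTSOn.blocks fillerKTS (inj₁ (lookup subBlockIndex j)))
                                (map₃ subPoint (STSOn.blocks fillerSub j))

  filler : Filler 12 12 12
  filler = record
    { b = 116 ; b′ = 26 ; kts = fillerKTS ; ∞-block = refl ; ∞-class = refl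
    ; sub = fillerSub ; subBlock = lookup subBlockIndex ; subBlock-image = subBlock-image }

-- Every block meets three groups, so a frame with a single group has no blocks, and its
-- partial classes may be replaced by any number of empty ones.
singleGroup-withClasses : ∀ {g h} s → KirkmanFrame₂ g h 1 →
  Σ (KirkmanFrame₂ g h 1) λ F → ∀ k → HasSize (λ c → KirkmanFrame.hole (KirkmanFrame₂.frame F) c ≡ k) s
singleGroup-withClasses s F =
  record F { frame = frame′ } , λ { zero → id , id , (λ _ → refl) , (λ c _ → c , refl) }
  where
  open KirkmanFrame (KirkmanFrame₂.frame F)
  open GDD gdd using (transv)
  single : ∀ (k k′ : Fin 1) → k ≡ k′
  single k k′ = ↔-injective 1↔⊤ refl
  noBlock : ∀ {A : Set} → Fin (GDD.b gdd) → A
  noBlock i = ⊥-elim (proj₁ (transv i) (single _ _))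
  frame′ : KirkmanFrame _ 1 _
  frame′ = record
    { gdd = gdd ; r = s ; cls = noBlock ; hole = λ _ → zero
    ; missHole = λ _ _ _ i _ _ → noBlock i
    ; parallel = λ _ x x≁hole → ⊥-elim (x≁hole (single _ _)) }

fillFrame : ∀ {g d u s} (F : KirkmanFrame₂ g (g + d) u) →
            (∀ k → HasSize (λ c → KirkmanFrame.hole (KirkmanFrame₂.frame F) c ≡ k) s) → Filler g d s →
            Σ (KTS ((g + d) * u + 3)) λ K → Subdesign (KTS.sts K) (g * u + 1)
fillFrame F holeClasses T =
  KTSOn-withSubdesign⇒KTS filledKTS filledSubdesign
    (⊎↔Fin ↔-refl ↔-refl)
    (⊎↔Fin ↔-refl (⊎↔Fin (×↔Fin ↔-refl ↔-refl) ⊤↔Fin1))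
    (⊎↔Fin (×↔Fin ↔-refl ↔-refl) ⊤↔Fin1)
    (⊎↔Fin ↔-refl ⊤↔Fin1)
    (⊎↔Fin ↔-refl (×↔Fin ↔-refl ↔-refl))
  where open Fill F holeClasses T

twelveClassesPerHole : ∀ n → 1 ≤ n → KirkmanFrame₂ 12 24 n →
  Σ (KirkmanFrame₂ 12 24 n) λ F → ∀ k → HasSize (λ c → KirkmanFrame.hole (KirkmanFrame₂.frame F) c ≡ k) 12
twelveClassesPerHole 0             () F
twelveClassesPerHole 1             _  F = singleGroup-withClasses 12 F
twelveClassesPerHole (suc (suc m)) _  F = F , holeClasses-size {11} {m} (KirkmanFrame₂.frame F)

lemma4p4 : ∀ (n : ℕ) → 1 ≤ n → KirkmanFrame₂ 12 24 n →
    Σ (KTS (24 * n + 3)) λ K → Subdesign (KTS.sts K) (12 * n + 1)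
lemma4p4 n 1≤n F = let (F′ , holeClasses) = twelveClassesPerHole n 1≤n F in fillFrame F′ holeClasses filler
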